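{- Let $A=\{\mathbf a_1,\dots,\mathbf a_n\}\subset\mathbb Z^d$ be a finite set generating $\mathbb Z^d$ as a lattice, let $Q$ be the semigroup generated by $A$, and let $K=\mathrm{cone}(A)$, assumed pointed with non-empty interior. A face $F$ of $K$ is almost saturated if and only if every fundamental hole $\mathbf y$ of $Q$ can be written as $$\mathbf y=x_1\mathbf a_1+\dots+x_n\mathbf a_n,\quad x_j\in\mathbb Z\ \text{for all } j,\ \text{and } x_j\ge 0 \text{ for every } j \text{ with } \mathbf a_j\notin F.$$ Equivalently, $F$ is nowhere saturated if and only if this system has no feasible solution for some fundamental hole $\mathbf y$.
   Context: $Q=\{\sum_i\lambda_i\mathbf a_i:\lambda_i\in\mathbb N\}$, $K=\{\sum_i\lambda_i\mathbf a_i:\lambda_i\in\mathbb R_{\ge0}\}$, $Q_{\rm sat}=K\cap\mathbb Z^d$. A fundamental hole is a nonzero $\mathbf y\in Q_{\rm sat}$ with $Q_{\rm sat}\cap\{\mathbf y-\mathbf q:\mathbf q\in Q\}=\{\mathbf y\}$. A point $\mathbf a\in Q$ is a saturation point if $\mathbf a+Q_{\rm sat}\subset Q$. A face $F$ of $K$ is almost saturated if it contains a saturation point of $Q$, and nowhere saturated otherwise. -}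

module Defs where

open import Data.Nat using (ℕ; zero; suc)
open import Data.Fin using (Fin; zero; suc)
open import Data.Integer as ℤ using (ℤ)
open import Data.Rational as ℚ using (ℚ; 0ℚ; _/_)
open import Data.Product using (Σ; ∃; _×_; _,_)
open import Relation.Binary.PropositionalEquality using (_≡_)
open import Relation.Nullary using (¬_)

ℤVec : ℕ → Set
ℤVec d = Fin d → ℤ

ℚVec : ℕ → Set
ℚVec d = Fin d → ℚ

sumℤ : ∀ {n} → (Fin n → ℤ) → ℤ
sumℤ {zero}  f = ℤ.+ 0
sumℤ {suc n} f = f zero ℤ.+ sumℤ (λ i → f (suc i))

sumℚ : ∀ {n} → (Fin n → ℚ) → ℚ
sumℚ {zero}  f = 0ℚ
sumℚ {suc n} f = f zero ℚ.+ sumℚ (λ i → f (suc i))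

toℚ : ℤ → ℚ
toℚ z = z / 1

toℚVec : ∀ {d} → ℤVec d → ℚVec d
toℚVec v k = toℚ (v k)

_≈ᵥ_ : ∀ {A : Set} {d} → (Fin d → A) → (Fin d → A) → Set
u ≈ᵥ v = ∀ k → u k ≡ v k

zeroᵥ : ∀ {d} → ℤVec d
zeroᵥ k = ℤ.+ 0

_+ᵥ_ : ∀ {d} → ℤVec d → ℤVec d → ℤVec d
(u +ᵥ v) k = u k ℤ.+ v k

_-ᵥ_ : ∀ {d} → ℤVec d → ℤVec d → ℤVec d
(u -ᵥ v) k = u k ℤ.- v k

-- A configuration A = {a_1,…,a_n} ⊂ ℤ^d, given as a family a : Fin n → ℤ^d.
-- Integer combination  Σ_j x_j a_j
intComb : ∀ {d n} → (Fin n → ℤVec d) → (Fin n → ℤ) → ℤVec d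
intComb a x k = sumℤ (λ j → x j ℤ.* a j k)

ratComb : ∀ {d n} → (Fin n → ℤVec d) → (Fin n → ℚ) → ℚVec d
ratComb a λ' k = sumℚ (λ j → λ' j ℚ.* toℚ (a j k))

dotℚ : ∀ {d} → ℚVec d → ℚVec d → ℚ
dotℚ c v = sumℚ (λ k → c k ℚ.* v k)

GeneratesLattice : ∀ {d n} → (Fin n → ℤVec d) → Set
GeneratesLattice {d} {n} a = ∀ (z : ℤVec d) → ∃ λ (x : Fin n → ℤ) → z ≈ᵥ intComb a x

InQ : ∀ {d n} → (Fin n → ℤVec d) → ℤVec d → Set
InQ {d} {n} a y = ∃ λ (μ : Fin n → ℕ) → y ≈ᵥ intComb a (λ j → ℤ.+ (μ j))

-- K = cone(A): non-negative combinations (rational points of K; coefficients in ℚ)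
InK : ∀ {d n} → (Fin n → ℤVec d) → ℚVec d → Set
InK {d} {n} a p = ∃ λ (λ' : Fin n → ℚ) → (∀ j → 0ℚ ℚ.≤ λ' j) × (p ≈ᵥ ratComb a λ')

InQsat : ∀ {d n} → (Fin n → ℤVec d) → ℤVec d → Set
InQsat a y = InK a (toℚVec y)

Pointed : ∀ {d n} → (Fin n → ℤVec d) → Set
Pointed {d} a = ∀ (p : ℚVec d) → InK a p → InK a (λ k → ℚ.- p k) → ∀ k → p k ≡ 0ℚ

FundamentalHole : ∀ {d n} → (Fin n → ℤVec d) → ℤVec d → Set
FundamentalHole {d} a y =
  ¬ (y ≈ᵥ zeroᵥ) × InQsat a y ×
  (∀ (q : ℤVec d) → InQ a q → InQsat a (y -ᵥ q) → (y -ᵥ q) ≈ᵥ y)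

SaturationPoint : ∀ {d n} → (Fin n → ℤVec d) → ℤVec d → Set
SaturationPoint {d} a p = InQ a p × (∀ (z : ℤVec d) → InQsat a z → InQ a (p +ᵥ z))

-- Faces of K: F = K ∩ {x : c·x = 0} for a linear functional c that is
-- non-negative on K (equivalently on every generator).  A face is represented
-- by such a (rational) functional c.
ValidFunctional : ∀ {d n} → (Fin n → ℤVec d) → ℚVec d → Set
ValidFunctional {d} a c = ∀ (p : ℚVec d) → InK a p → 0ℚ ℚ.≤ dotℚ c p

InFace : ∀ {d n} → (Fin n → ℤVec d) → ℚVec d → ℚVec d → Set
InFace a c p = InK a p × (dotℚ c p ≡ 0ℚ)

AlmostSaturated : ∀ {d n} → (Fin n → ℤVec d) → ℚVec d → Set
AlmostSaturated {d} a c = ∃ λ (p : ℤVec d) → SaturationPoint a p × InFace a c (toℚVec p)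

HoleSystemFeasible : ∀ {d n} → (Fin n → ℤVec d) → ℚVec d → ℤVec d → Set
HoleSystemFeasible {d} {n} a c y =
  ∃ λ (x : Fin n → ℤ) → (y ≈ᵥ intComb a x) ×
          (∀ j → ¬ InFace a c (toℚVec (a j)) → ℤ.+ 0 ℤ.≤ x j)

-- If p = Σ μⱼ aⱼ is a saturation point on the face F = {c = 0}, then c(p) = Σ μⱼ c(aⱼ) = 0 with
-- every term non-negative, so μⱼ > 0 only for aⱼ ∈ F; for a fundamental hole y, writing p + y ∈ Q
-- as Σ νⱼ aⱼ gives y = Σ (νⱼ − μⱼ) aⱼ, with negative coefficients only on F.
--
-- Conversely, taking integer parts of rational coefficients writes every z ∈ Q_sat as a point of Q
-- plus a point b ∈ Q_sat of the finite box |b_k| ≤ Σⱼ |a_jk|.  For each fundamental hole s of the box,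
-- a solution x of its system gives s + Σ x⁻ⱼ aⱼ ∈ Q with x⁻ supported on F; the sum p of all these
-- Σ x⁻ⱼ aⱼ lies in Q ∩ F and p + s ∈ Q for every such s.  A nonzero box point b ∈ Q_sat that is not a
-- hole has b − aⱼ ∈ Q_sat for some nonzero generator, hence b = b' + w with b' in the box and 0 ≠ w ∈ Q;
-- since K is pointed, fewer box points s satisfy b' − s ∈ Q_sat than b − s ∈ Q_sat, so induction on
-- that number gives p + b ∈ Q.  Membership in Q_sat is decided by Fourier–Motzkin elimination, which
-- makes the choice of holes, and so p, constructive.

module Submission where

open import Defs
open import Data.Nat using (ℕ)
open import Data.Fin using (Fin)
open import Function.Bundles using (_⇔_)

open import Data.Nat as ℕ using (zero; suc; z≤n; s≤s)
import Data.Nat.Properties as ℕP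
open import Data.Nat.ListAction using (sum)
open import Data.Nat.DivMod using (_/_; m≡m%n+[m/n]*n; m%n<n; m/n*n≤m)
open import Data.Integer as ℤ using (ℤ; +_; -[1+_])
import Data.Integer.Properties as ℤP
open import Data.Rational as ℚ using (ℚ; 0ℚ; 1ℚ; mkℚ)
import Data.Rational.Properties as ℚP
import Data.Rational.Unnormalised.Properties as ℚᵘP
open import Data.Rational.Unnormalised using (*≡*)
open import Data.Nat.Coprimality using (1-coprimeTo)
import Data.Nat.Coprimality as Coprime
open import Data.Fin using (zero; suc)
open import Data.Fin.Properties using (all?; any?)
open import Data.Vec.Functional using (head; tail) renaming (_∷_ to _∷ᵥ_)
open import Data.List using (List; []; _∷_; _++_; map; tabulate; cartesianProductWith; applyUpTo; filter; length)
open import Data.List.Relation.Unary.Any using (here; there)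
open import Data.List.Membership.Propositional using (_∈_)
open import Data.List.Membership.Propositional.Properties
  using (∈-map⁺; ∈-++⁺ˡ; ∈-++⁺ʳ; ∈-applyUpTo⁺; ∈-cartesianProductWith⁺)
open import Data.List.Relation.Unary.All as All using (All; []; _∷_)
import Data.List.Relation.Unary.All.Properties as All
open import Data.Product using (∃; _×_; _,_; proj₁; proj₂)
open import Data.Sum using (_⊎_; inj₁; inj₂; [_,_]′)
open import Data.Nat.Induction using (<-wellFounded)
open import Induction.WellFounded using (Acc; acc)
open import Data.Empty using (⊥-elim)
open import Function using (_∘_)
open import Function.Bundles using (mk⇔; Equivalence)
open import Relation.Nullary using (Dec; yes; no; ¬_)
open import Relation.Unary using (Decidable)
open import Relation.Nullary.Decidable using (map′; ¬?; _×-dec_; _→-dec_)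
open import Relation.Binary.PropositionalEquality
open import Relation.Binary.Definitions using (tri<; tri≈; tri>)
open import Data.Rational.Solver using (module +-*-Solver)
import Data.Integer.Solver as ℤ-Solver
open import Algebra.Bundles using (CommutativeMonoid)
open import Relation.Binary.Bundles using (DecTotalOrder)
open import Algebra.Properties.CommutativeSemigroup ℤP.+-commutativeSemigroup
  using () renaming (interchange to ℤ-+-interchange)
open import Algebra.Properties.CommutativeSemigroup
  (CommutativeMonoid.commutativeSemigroup ℚP.+-0-commutativeMonoid)
  using () renaming (interchange to ℚ-+-interchange)

-- Finite sums

sumℚ-cong : ∀ {n} {f g : Fin n → ℚ} → (∀ i → f i ≡ g i) → sumℚ f ≡ sumℚ g
sumℚ-cong {zero}  f≡g = refl
sumℚ-cong {suc n} f≡g = cong₂ ℚ._+_ (f≡g zero) (sumℚ-cong (f≡g ∘ suc))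

sumℚ-zero : ∀ n → sumℚ {n} (λ _ → 0ℚ) ≡ 0ℚ
sumℚ-zero zero    = refl
sumℚ-zero (suc n) = trans (ℚP.+-identityˡ _) (sumℚ-zero n)

sumℚ-+ : ∀ {n} (f g : Fin n → ℚ) → sumℚ (λ i → f i ℚ.+ g i) ≡ sumℚ f ℚ.+ sumℚ g
sumℚ-+ {zero}  f g = sym (ℚP.+-identityˡ 0ℚ)
sumℚ-+ {suc n} f g = trans (cong (f zero ℚ.+ g zero ℚ.+_) (sumℚ-+ (f ∘ suc) (g ∘ suc)))
  (ℚ-+-interchange (f zero) (g zero) (sumℚ (f ∘ suc)) (sumℚ (g ∘ suc)))

sumℚ-neg : ∀ {n} (f : Fin n → ℚ) → sumℚ (λ i → ℚ.- f i) ≡ ℚ.- sumℚ f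
sumℚ-neg {zero}  f = refl
sumℚ-neg {suc n} f = trans (cong (ℚ.- f zero ℚ.+_) (sumℚ-neg (f ∘ suc)))
  (sym (ℚP.neg-distrib-+ (f zero) _))

sumℚ-*ˡ : ∀ {n} c (f : Fin n → ℚ) → sumℚ (λ i → c ℚ.* f i) ≡ c ℚ.* sumℚ f
sumℚ-*ˡ {zero}  c f = sym (ℚP.*-zeroʳ c)
sumℚ-*ˡ {suc n} c f = trans (cong (c ℚ.* f zero ℚ.+_) (sumℚ-*ˡ c (f ∘ suc)))
  (sym (ℚP.*-distribˡ-+ c (f zero) _))

sumℚ-comm : ∀ {m n} (f : Fin m → Fin n → ℚ) →
  sumℚ (λ i → sumℚ (f i)) ≡ sumℚ (λ j → sumℚ (λ i → f i j))
sumℚ-comm {zero}  {n} f = sym (sumℚ-zero n)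
sumℚ-comm {suc m} f = trans (cong (sumℚ (f zero) ℚ.+_) (sumℚ-comm (f ∘ suc)))
  (sym (sumℚ-+ (f zero) _))

sumℚ-mono-≤ : ∀ {n} {f g : Fin n → ℚ} → (∀ i → f i ℚ.≤ g i) → sumℚ f ℚ.≤ sumℚ g
sumℚ-mono-≤ {zero}  f≤g = ℚP.≤-refl
sumℚ-mono-≤ {suc n} f≤g = ℚP.+-mono-≤ (f≤g zero) (sumℚ-mono-≤ (f≤g ∘ suc))

sumℚ-nonNeg : ∀ {n} {f : Fin n → ℚ} → (∀ i → 0ℚ ℚ.≤ f i) → 0ℚ ℚ.≤ sumℚ f
sumℚ-nonNeg {n} {f} 0≤f = subst (ℚ._≤ sumℚ f) (sumℚ-zero n) (sumℚ-mono-≤ 0≤f)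

sumℚ-nonNeg-≡0 : ∀ {n} {f : Fin n → ℚ} → (∀ i → 0ℚ ℚ.≤ f i) → sumℚ f ≡ 0ℚ → ∀ i → f i ≡ 0ℚ
sumℚ-nonNeg-≡0 {suc n} {f} 0≤f Σf≡0 = λ
  { zero    → ℚP.≤-antisym (head≤Σf) (0≤f zero)
  ; (suc i) → sumℚ-nonNeg-≡0 (0≤f ∘ suc) (ℚP.≤-antisym tail≤Σf (sumℚ-nonNeg (0≤f ∘ suc))) i }
  where
  head≤Σf : f zero ℚ.≤ 0ℚ
  head≤Σf = subst₂ ℚ._≤_ (ℚP.+-identityʳ _) Σf≡0 (ℚP.+-monoʳ-≤ (f zero) (sumℚ-nonNeg (0≤f ∘ suc)))
  tail≤Σf : sumℚ (f ∘ suc) ℚ.≤ 0ℚ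
  tail≤Σf = subst₂ ℚ._≤_ (ℚP.+-identityˡ _) Σf≡0 (ℚP.+-monoˡ-≤ (sumℚ (f ∘ suc)) (0≤f zero))

dotℚ-comm : ∀ {n} (u x : Fin n → ℚ) → dotℚ u x ≡ dotℚ x u
dotℚ-comm u x = sumℚ-cong (λ i → ℚP.*-comm (u i) (x i))

dotℚ-*ˡ : ∀ {n} s (u x : Fin n → ℚ) → dotℚ (λ i → s ℚ.* u i) x ≡ s ℚ.* dotℚ u x
dotℚ-*ˡ s u x = trans (sumℚ-cong (λ i → ℚP.*-assoc s (u i) (x i))) (sumℚ-*ˡ s (λ i → u i ℚ.* x i))

dotℚ-+ˡ : ∀ {n} (u v x : Fin n → ℚ) → dotℚ (λ i → u i ℚ.+ v i) x ≡ dotℚ u x ℚ.+ dotℚ v x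
dotℚ-+ˡ u v x = trans (sumℚ-cong (λ i → ℚP.*-distribʳ-+ (x i) (u i) (v i)))
  (sumℚ-+ (λ i → u i ℚ.* x i) (λ i → v i ℚ.* x i))

dotℚ-subˡ : ∀ {n} (u v x : Fin n → ℚ) → dotℚ (λ i → u i ℚ.- v i) x ≡ dotℚ u x ℚ.- dotℚ v x
dotℚ-subˡ u v x = begin
  dotℚ (λ i → u i ℚ.- v i) x                       ≡⟨ dotℚ-+ˡ u (λ i → ℚ.- v i) x ⟩
  dotℚ u x ℚ.+ sumℚ (λ i → ℚ.- v i ℚ.* x i)        ≡⟨ cong (dotℚ u x ℚ.+_) (trans
                                                       (sumℚ-cong (λ i → sym (ℚP.neg-distribˡ-* (v i) (x i))))
                                                       (sumℚ-neg (λ i → v i ℚ.* x i))) ⟩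
  dotℚ u x ℚ.- dotℚ v x                            ∎
  where open ≡-Reasoning

∣sumℚ∣≤sumℚ∣∣ : ∀ {n} (f : Fin n → ℚ) → ℚ.∣ sumℚ f ∣ ℚ.≤ sumℚ (λ i → ℚ.∣ f i ∣)
∣sumℚ∣≤sumℚ∣∣ {zero}  f = ℚP.≤-refl
∣sumℚ∣≤sumℚ∣∣ {suc n} f = ℚP.≤-trans (ℚP.∣p+q∣≤∣p∣+∣q∣ (f zero) _)
  (ℚP.+-monoʳ-≤ ℚ.∣ f zero ∣ (∣sumℚ∣≤sumℚ∣∣ (f ∘ suc)))

sumℤ-cong : ∀ {n} {f g : Fin n → ℤ} → (∀ i → f i ≡ g i) → sumℤ f ≡ sumℤ g
sumℤ-cong {zero}  f≡g = refl
sumℤ-cong {suc n} f≡g = cong₂ ℤ._+_ (f≡g zero) (sumℤ-cong (f≡g ∘ suc))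

sumℤ-zero : ∀ n → sumℤ {n} (λ _ → + 0) ≡ + 0
sumℤ-zero zero    = refl
sumℤ-zero (suc n) = trans (ℤP.+-identityˡ _) (sumℤ-zero n)

sumℤ-+ : ∀ {n} (f g : Fin n → ℤ) → sumℤ (λ i → f i ℤ.+ g i) ≡ sumℤ f ℤ.+ sumℤ g
sumℤ-+ {zero}  f g = refl
sumℤ-+ {suc n} f g = trans (cong (ℤ._+_ (f zero ℤ.+ g zero)) (sumℤ-+ (f ∘ suc) (g ∘ suc)))
  (ℤ-+-interchange (f zero) (g zero) (sumℤ (f ∘ suc)) (sumℤ (g ∘ suc)))

sumℤ-neg : ∀ {n} (f : Fin n → ℤ) → sumℤ (λ i → ℤ.- f i) ≡ ℤ.- sumℤ f
sumℤ-neg {zero}  f = refl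
sumℤ-neg {suc n} f = trans (cong (ℤ._+_ (ℤ.- f zero)) (sumℤ-neg (f ∘ suc)))
  (sym (ℤP.neg-distrib-+ (f zero) _))

δ : ∀ {n} → Fin n → Fin n → ℕ
δ zero    zero    = 1
δ zero    (suc i) = 0
δ (suc j) zero    = 0
δ (suc j) (suc i) = δ j i

sumℤ-δ : ∀ {n} (j : Fin n) (x : Fin n → ℤ) → sumℤ (λ i → + δ j i ℤ.* x i) ≡ x j
sumℤ-δ {suc n} zero x = begin
  + 1 ℤ.* x zero ℤ.+ sumℤ (λ i → + 0 ℤ.* x (suc i)) ≡⟨ cong₂ ℤ._+_ (ℤP.*-identityˡ (x zero)) (sumℤ-zero n) ⟩
  x zero ℤ.+ + 0                                       ≡⟨ ℤP.+-identityʳ (x zero) ⟩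
  x zero                                               ∎
  where open ≡-Reasoning
sumℤ-δ {suc n} (suc j) x = trans (ℤP.+-identityˡ _) (sumℤ-δ j (x ∘ suc))

δ≤ : ∀ {n} {μ : Fin n → ℕ} (j : Fin n) → μ j ≢ 0 → ∀ i → δ j i ℕ.≤ μ i
δ≤ {μ = μ} zero    μ₀≢0 zero    = ℕP.n≢0⇒n>0 μ₀≢0
δ≤         zero    _    (suc i) = z≤n
δ≤         (suc j) _    zero    = z≤n
δ≤         (suc j) μⱼ≢0 (suc i) = δ≤ j μⱼ≢0 i

-- The embedding ℤ → ℚ and integer parts

fromℤ : ℤ → ℚ
fromℤ z = mkℚ z 0 (Coprime.sym (1-coprimeTo ℤ.∣ z ∣))

toℚ≡fromℤ : ∀ z → toℚ z ≡ fromℤ z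
toℚ≡fromℤ z = ℚP.↥p/↧p≡p (fromℤ z)

toℚ-+ : ∀ x y → toℚ (x ℤ.+ y) ≡ toℚ x ℚ.+ toℚ y
toℚ-+ x y rewrite toℚ≡fromℤ (x ℤ.+ y) | toℚ≡fromℤ x | toℚ≡fromℤ y =
  ℚP.toℚᵘ-injective (ℚᵘP.≃-trans (*≡* x+y≡x+y) (ℚᵘP.≃-sym (ℚP.toℚᵘ-homo-+ (fromℤ x) (fromℤ y))))
  where
  x+y≡x+y : (x ℤ.+ y) ℤ.* + 1 ≡ (x ℤ.* + 1 ℤ.+ y ℤ.* + 1) ℤ.* + 1
  x+y≡x+y rewrite ℤP.*-identityʳ x | ℤP.*-identityʳ y = refl

toℚ-* : ∀ x y → toℚ (x ℤ.* y) ≡ toℚ x ℚ.* toℚ y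
toℚ-* x y rewrite toℚ≡fromℤ (x ℤ.* y) | toℚ≡fromℤ x | toℚ≡fromℤ y =
  ℚP.toℚᵘ-injective (ℚᵘP.≃-trans (*≡* refl) (ℚᵘP.≃-sym (ℚP.toℚᵘ-homo-* (fromℤ x) (fromℤ y))))

toℚ-neg : ∀ x → toℚ (ℤ.- x) ≡ ℚ.- toℚ x
toℚ-neg x rewrite toℚ≡fromℤ (ℤ.- x) | toℚ≡fromℤ x =
  ℚP.toℚᵘ-injective (ℚᵘP.≃-trans (*≡* refl) (ℚᵘP.≃-sym (ℚP.toℚᵘ-homo‿- (fromℤ x))))

toℚ-sub : ∀ x y → toℚ (x ℤ.- y) ≡ toℚ x ℚ.- toℚ y
toℚ-sub x y = trans (toℚ-+ x (ℤ.- y)) (cong (toℚ x ℚ.+_) (toℚ-neg y))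

toℚ-∣∣ : ∀ z → toℚ (+ ℤ.∣ z ∣) ≡ ℚ.∣ toℚ z ∣
toℚ-∣∣ z rewrite toℚ≡fromℤ (+ ℤ.∣ z ∣) | toℚ≡fromℤ z = refl

toℚ-mono-≤ : ∀ {x y} → x ℤ.≤ y → toℚ x ℚ.≤ toℚ y
toℚ-mono-≤ {x} {y} x≤y rewrite toℚ≡fromℤ x | toℚ≡fromℤ y =
  ℚ.*≤* (subst₂ ℤ._≤_ (sym (ℤP.*-identityʳ x)) (sym (ℤP.*-identityʳ y)) x≤y)

toℚ-cancel-≤ : ∀ {x y} → toℚ x ℚ.≤ toℚ y → x ℤ.≤ y
toℚ-cancel-≤ {x} {y} x≤y rewrite toℚ≡fromℤ x | toℚ≡fromℤ y =
  subst₂ ℤ._≤_ (ℤP.*-identityʳ x) (ℤP.*-identityʳ y) (ℚP.drop-*≤* x≤y)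

toℚ-injective : ∀ {x y} → toℚ x ≡ toℚ y → x ≡ y
toℚ-injective {x} {y} eq rewrite toℚ≡fromℤ x | toℚ≡fromℤ y = cong ℚ.numerator eq

toℚ-nonNeg : ∀ m → 0ℚ ℚ.≤ toℚ (+ m)
toℚ-nonNeg m = toℚ-mono-≤ {+ 0} {+ m} (ℤ.+≤+ z≤n)

toℚ-sumℤ : ∀ {n} (f : Fin n → ℤ) → toℚ (sumℤ f) ≡ sumℚ (toℚ ∘ f)
toℚ-sumℤ {zero}  f = refl
toℚ-sumℤ {suc n} f = trans (toℚ-+ (f zero) _) (cong (toℚ (f zero) ℚ.+_) (toℚ-sumℤ (f ∘ suc)))

sumℚ-δ : ∀ {n} (j : Fin n) (x : Fin n → ℚ) → sumℚ (λ i → toℚ (+ δ j i) ℚ.* x i) ≡ x j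
sumℚ-δ {suc n} zero x = begin
  1ℚ ℚ.* x zero ℚ.+ sumℚ (λ i → 0ℚ ℚ.* x (suc i)) ≡⟨ cong₂ ℚ._+_ (ℚP.*-identityˡ (x zero))
                                                       (trans (sumℚ-cong (ℚP.*-zeroˡ ∘ x ∘ suc)) (sumℚ-zero n)) ⟩
  x zero ℚ.+ 0ℚ                                      ≡⟨ ℚP.+-identityʳ (x zero) ⟩
  x zero                                             ∎
  where open ≡-Reasoning
sumℚ-δ {suc n} (suc j) x = trans (cong (ℚ._+ sumℚ (λ i → toℚ (+ δ j i) ℚ.* x (suc i))) (ℚP.*-zeroˡ (x zero)))
  (trans (ℚP.+-identityˡ _) (sumℚ-δ j (x ∘ suc)))

0≤-⇔≤ : ∀ {p q} → 0ℚ ℚ.≤ p ℚ.- q ⇔ q ℚ.≤ p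
0≤-⇔≤ {p} {q} = mk⇔
  (subst₂ ℚ._≤_ (ℚP.+-identityˡ q) (solve 2 (λ p q → (p :- q) :+ q := p) refl p q) ∘ ℚP.+-monoˡ-≤ q)
  (subst₂ ℚ._≤_ (ℚP.+-inverseʳ q) refl ∘ ℚP.+-monoˡ-≤ (ℚ.- q))
  where open +-*-Solver using (solve; _:+_; _:-_; _:=_)

0≤+⇔-≤ : ∀ {p q} → 0ℚ ℚ.≤ p ℚ.+ q ⇔ ℚ.- q ℚ.≤ p
0≤+⇔-≤ {p} {q} = mk⇔
  (subst₂ ℚ._≤_ (ℚP.+-identityˡ (ℚ.- q)) (solve 2 (λ p q → (p :+ q) :- q := p) refl p q) ∘ ℚP.+-monoˡ-≤ (ℚ.- q))
  (subst₂ ℚ._≤_ (ℚP.+-inverseˡ q) refl ∘ ℚP.+-monoˡ-≤ q)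
  where open +-*-Solver using (solve; _:+_; _:-_; _:=_)

p*q≡0⇒q≡0 : ∀ p q → p ≢ 0ℚ → p ℚ.* q ≡ 0ℚ → q ≡ 0ℚ
p*q≡0⇒q≡0 p q p≢0 pq≡0 = begin
  q                          ≡⟨ ℚP.*-identityˡ q ⟨
  1ℚ ℚ.* q                   ≡⟨ cong (ℚ._* q) (ℚP.*-inverseˡ p) ⟨
  ℚ.1/ p ℚ.* p ℚ.* q         ≡⟨ ℚP.*-assoc (ℚ.1/ p) p q ⟩
  ℚ.1/ p ℚ.* (p ℚ.* q)       ≡⟨ cong (ℚ.1/ p ℚ.*_) pq≡0 ⟩
  ℚ.1/ p ℚ.* 0ℚ              ≡⟨ ℚP.*-zeroʳ (ℚ.1/ p) ⟩
  0ℚ                         ∎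
  where
  open ≡-Reasoning
  instance _ = ℚ.≢-nonZero p≢0

nonNeg-floor : (q : ℚ) → 0ℚ ℚ.≤ q → ∃ λ m → toℚ (+ m) ℚ.≤ q × q ℚ.≤ toℚ (+ suc m)
nonNeg-floor (mkℚ (+ n) d-1 _) _ = n / d , m≤q , q≤m+1
  where
  d = suc d-1
  m≤q : toℚ (+ (n / d)) ℚ.≤ mkℚ (+ n) d-1 _
  m≤q rewrite toℚ≡fromℤ (+ (n / d)) = ℚ.*≤* (subst₂ ℤ._≤_ (ℤP.pos-* (n / d) d) (ℤP.pos-* n 1)
    (ℤ.+≤+ (subst (n / d ℕ.* d ℕ.≤_) (sym (ℕP.*-identityʳ n)) (m/n*n≤m n d))))
  q≤m+1 : mkℚ (+ n) d-1 _ ℚ.≤ toℚ (+ suc (n / d))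
  q≤m+1 rewrite toℚ≡fromℤ (+ suc (n / d)) = ℚ.*≤* (subst₂ ℤ._≤_ (ℤP.pos-* n 1) (ℤP.pos-* (suc (n / d)) d)
    (ℤ.+≤+ (subst (ℕ._≤ suc (n / d) ℕ.* d) (sym (ℕP.*-identityʳ n)) (ℕP.<⇒≤ n<[1+n/d]*d))))
    where
    n<[1+n/d]*d : n ℕ.< suc (n / d) ℕ.* d
    n<[1+n/d]*d = subst (ℕ._< suc (n / d) ℕ.* d) (sym (m≡m%n+[m/n]*n n d)) (ℕP.+-monoˡ-< (n / d ℕ.* d) (m%n<n n d))
nonNeg-floor (mkℚ -[1+ _ ] _ _) 0≤q with () ← ℚ.nonNegative 0≤q

fractionalPart : (q : ℚ) → 0ℚ ℚ.≤ q → ∃ λ m → 0ℚ ℚ.≤ q ℚ.- toℚ (+ m) × q ℚ.- toℚ (+ m) ℚ.≤ 1ℚ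
fractionalPart q 0≤q = let m , m≤q , q≤m+1 = nonNeg-floor q 0≤q in
  m , Equivalence.from 0≤-⇔≤ m≤q , subst₂ ℚ._≤_ refl ([1+m]-m≡1 (toℚ (+ m)))
    (ℚP.+-monoˡ-≤ (ℚ.- toℚ (+ m)) (subst (q ℚ.≤_) (toℚ-+ (+ 1) (+ m)) q≤m+1))
  where
  open +-*-Solver using (solve; _:+_; _:-_; _:=_; con)
  [1+m]-m≡1 : ∀ x → 1ℚ ℚ.+ x ℚ.- x ≡ 1ℚ
  [1+m]-m≡1 = solve 1 (λ x → con 1ℚ :+ x :- x := con 1ℚ) refl

-- Integer points of a box, and counting

integersWithin : ℕ → List ℤ
integersWithin B = applyUpTo +_ (suc B) ++ applyUpTo -[1+_] B

∈-integersWithin : ∀ {z B} → ℤ.∣ z ∣ ℕ.≤ B → z ∈ integersWithin B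
∈-integersWithin {+ k}          k≤B = ∈-++⁺ˡ (∈-applyUpTo⁺ +_ (s≤s k≤B))
∈-integersWithin { -[1+ k ]} {B} k<B = ∈-++⁺ʳ (applyUpTo +_ (suc B)) (∈-applyUpTo⁺ -[1+_] k<B)

box : ∀ {d} → (Fin d → ℕ) → List (ℤVec d)
box {zero}  B = (λ ()) ∷ []
box {suc d} B = cartesianProductWith _∷ᵥ_ (integersWithin (head B)) (box (tail B))

∈-box : ∀ {d} (B : Fin d → ℕ) (v : ℤVec d) → (∀ k → ℤ.∣ v k ∣ ℕ.≤ B k) → ∃ λ b → b ∈ box B × v ≈ᵥ b
∈-box {zero}  B v _   = (λ ()) , here refl , λ ()
∈-box {suc d} B v v≤B = let b , b∈ , tail-v≈b = ∈-box (tail B) (tail v) (v≤B ∘ suc) in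
  (v zero ∷ᵥ b) , ∈-cartesianProductWith⁺ _∷ᵥ_ (∈-integersWithin (v≤B zero)) b∈ ,
  λ { zero → refl ; (suc k) → tail-v≈b k }

count : ∀ {A : Set} {P : A → Set} → Decidable P → List A → ℕ
count P? xs = length (filter P? xs)

module _ {A : Set} {P Q : A → Set} (P? : Decidable P) (Q? : Decidable Q) (P⇒Q : ∀ {x} → P x → Q x) where

  count-mono : ∀ xs → count P? xs ℕ.≤ count Q? xs
  count-mono []       = z≤n
  count-mono (x ∷ xs) with P? x | Q? x
  ... | yes _  | yes _  = s≤s (count-mono xs)
  ... | yes px | no ¬qx = ⊥-elim (¬qx (P⇒Q px))
  ... | no _   | yes _  = ℕP.m≤n⇒m≤1+n (count-mono xs)
  ... | no _   | no _   = count-mono xs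

  count-< : ∀ {y} xs → y ∈ xs → Q y → ¬ P y → count P? xs ℕ.< count Q? xs
  count-< (x ∷ xs) (here refl) qx ¬px with P? x | Q? x
  ... | yes px | _      = ⊥-elim (¬px px)
  ... | no _   | yes _  = s≤s (count-mono xs)
  ... | no _   | no ¬qx = ⊥-elim (¬qx qx)
  count-< (x ∷ xs) (there y∈) qy ¬py with P? x | Q? x
  ... | yes _  | yes _  = s≤s (count-< xs y∈ qy ¬py)
  ... | yes px | no ¬qx = ⊥-elim (¬qx (P⇒Q px))
  ... | no _   | yes _  = ℕP.m<n⇒m<1+n (count-< xs y∈ qy ¬py)
  ... | no _   | no _   = count-< xs y∈ qy ¬py

∈⇒≤sum-map : ∀ {A : Set} (f : A → ℕ) {y xs} → y ∈ xs → f y ℕ.≤ sum (map f xs)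
∈⇒≤sum-map f (here refl)             = ℕP.m≤m+n (f _) _
∈⇒≤sum-map f {xs = x ∷ _} (there y∈) = ℕP.≤-trans (∈⇒≤sum-map f y∈) (ℕP.m≤n+m _ (f x))

sum-map-zero : ∀ {A : Set} (f : A → ℕ) → (∀ x → f x ≡ 0) → ∀ xs → sum (map f xs) ≡ 0
sum-map-zero f f≡0 []       = refl
sum-map-zero f f≡0 (x ∷ xs) = cong₂ ℕ._+_ (f≡0 x) (sum-map-zero f f≡0 xs)

≈ᵥ0? : ∀ {m} (y : ℤVec m) → Dec (y ≈ᵥ zeroᵥ)
≈ᵥ0? y = all? (λ k → y k ℤ.≟ + 0)

negPart posPart : ℤ → ℕ
negPart (+ _)      = 0
negPart -[1+ k ]   = suc k
posPart (+ k)      = k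
posPart -[1+ _ ]   = 0

i+negPart≡posPart : ∀ i → i ℤ.+ + negPart i ≡ + posPart i
i+negPart≡posPart (+ k)    = ℤP.+-identityʳ (+ k)
i+negPart≡posPart -[1+ k ] = ℤP.+-inverseˡ (+ suc k)

0≤i⇒negPart≡0 : ∀ {i} → + 0 ℤ.≤ i → negPart i ≡ 0
0≤i⇒negPart≡0 (ℤ.+≤+ _) = refl

-- Feasibility of rational linear inequalities (Fourier–Motzkin)

module FourierMotzkin where

  open import Data.Rational using (_+_; _-_; _*_; -_; _≤_; 1/_; NonZero; Positive; Negative)
  open +-*-Solver using (solve; _:+_; _:-_; _:*_; :-_; _:=_)

  record Affine (m : ℕ) : Set where
    constructor affine
    field
      const : ℚ
      coeff : Fin m → ℚ
  open Affine public

  eval : ∀ {m} → Affine m → (Fin m → ℚ) → ℚ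
  eval f x = const f + dotℚ (coeff f) x

  _⊨_ : ∀ {m} → (Fin m → ℚ) → Affine m → Set
  x ⊨ f = 0ℚ ≤ eval f x

  _⊨*_ : ∀ {m} → (Fin m → ℚ) → List (Affine m) → Set
  x ⊨* fs = All (x ⊨_) fs

  _·ᵃ_ : ∀ {m} → ℚ → Affine m → Affine m
  s ·ᵃ f = affine (s * const f) (λ i → s * coeff f i)

  _-ᵃ_ : ∀ {m} → Affine m → Affine m → Affine m
  f -ᵃ g = affine (const f - const g) (λ i → coeff f i - coeff g i)

  dropHead : ∀ {m} → Affine (suc m) → Affine m
  dropHead f = affine (const f) (tail (coeff f))

  eval-·ᵃ : ∀ {m} s (f : Affine m) x → eval (s ·ᵃ f) x ≡ s * eval f x
  eval-·ᵃ s f x = begin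
    s * const f + dotℚ (λ i → s * coeff f i) x  ≡⟨ cong (_+_ (s * const f)) (dotℚ-*ˡ s (coeff f) x) ⟩
    s * const f + s * dotℚ (coeff f) x          ≡⟨ ℚP.*-distribˡ-+ s _ _ ⟨
    s * eval f x                                ∎
    where open ≡-Reasoning

  eval-subᵃ : ∀ {m} (f g : Affine m) x → eval (f -ᵃ g) x ≡ eval f x - eval g x
  eval-subᵃ f g x = begin
    const f - const g + dotℚ (λ i → coeff f i - coeff g i) x
      ≡⟨ cong (_+_ (const f - const g)) (dotℚ-subˡ (coeff f) (coeff g) x) ⟩
    const f - const g + (dotℚ (coeff f) x - dotℚ (coeff g) x)
      ≡⟨ solve 4 (λ a b c d → (a :- b) :+ (c :- d) := (a :+ c) :- (b :+ d)) refl
           (const f) (const g) (dotℚ (coeff f) x) (dotℚ (coeff g) x) ⟩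
    eval f x - eval g x
      ∎
    where open ≡-Reasoning

  eval-∷ : ∀ {m} (f : Affine (suc m)) x₀ x → eval f (x₀ ∷ᵥ x) ≡ coeff f zero * x₀ + eval (dropHead f) x
  eval-∷ f x₀ x = solve 3 (λ c a s → c :+ (a :+ s) := a :+ (c :+ s)) refl
    (const f) (coeff f zero * x₀) (dotℚ (tail (coeff f)) x)

  module _ (k t x : ℚ) .{{_ : NonZero k}} where

    root : ℚ
    root = - (1/ k) * t

    root*k≡-t : root * k ≡ - t
    root*k≡-t = begin
      - (1/ k) * t * k    ≡⟨ solve 3 (λ v t k → :- v :* t :* k := :- t :* (v :* k)) refl (1/ k) t k ⟩
      - t * ((1/ k) * k)  ≡⟨ cong (- t *_) (ℚP.*-inverseˡ k) ⟩
      - t * 1ℚ            ≡⟨ ℚP.*-identityʳ (- t) ⟩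
      - t                 ∎
      where open ≡-Reasoning

    -t≤kx⇔root*k≤x*k : - t ≤ k * x ⇔ root * k ≤ x * k
    -t≤kx⇔root*k≤x*k = subst₂ (λ l r → - t ≤ k * x ⇔ l ≤ r) (sym root*k≡-t) (ℚP.*-comm k x) (mk⇔ (λ h → h) (λ h → h))

    0≤kx+t⇔root≤x : Positive k → 0ℚ ≤ k * x + t ⇔ root ≤ x
    0≤kx+t⇔root≤x k>0 = mk⇔
      (ℚP.*-cancelʳ-≤-pos k {{k>0}} ∘ Equivalence.to -t≤kx⇔root*k≤x*k ∘ Equivalence.to 0≤+⇔-≤)
      (Equivalence.from 0≤+⇔-≤ ∘ Equivalence.from -t≤kx⇔root*k≤x*k ∘ ℚP.*-monoʳ-≤-nonNeg k {{ℚP.pos⇒nonNeg k {{k>0}}}})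

    0≤kx+t⇔x≤root : Negative k → 0ℚ ≤ k * x + t ⇔ x ≤ root
    0≤kx+t⇔x≤root k<0 = mk⇔
      (ℚP.*-cancelʳ-≤-neg k {{k<0}} ∘ Equivalence.to -t≤kx⇔root*k≤x*k ∘ Equivalence.to 0≤+⇔-≤)
      (Equivalence.from 0≤+⇔-≤ ∘ Equivalence.from -t≤kx⇔root*k≤x*k ∘ ℚP.*-monoʳ-≤-nonPos k {{ℚP.neg⇒nonPos k {{k<0}}}})

  data Bound (m : ℕ) : Set where
    lower upper free : Affine m → Bound m

  Holds : ∀ {m} → ℚ → (Fin m → ℚ) → Bound m → Set
  Holds x₀ x (lower f) = eval f x ≤ x₀
  Holds x₀ x (upper f) = x₀ ≤ eval f x
  Holds x₀ x (free f)  = x ⊨ f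

  solveForHead : ∀ {m} (f : Affine (suc m)) .{{_ : NonZero (coeff f zero)}} → Affine m
  solveForHead f = (- (1/ coeff f zero)) ·ᵃ dropHead f

  classify : ∀ {m} → Affine (suc m) → Bound m
  classify f with ℚP.<-cmp (coeff f zero) 0ℚ
  ... | tri< k<0 _ _ = upper (solveForHead f {{ℚ.<-nonZero k<0}})
  ... | tri≈ _ _ _   = free (dropHead f)
  ... | tri> _ _ k>0 = lower (solveForHead f {{ℚ.>-nonZero k>0}})

  classify-correct : ∀ {m} (f : Affine (suc m)) x₀ x → (x₀ ∷ᵥ x) ⊨ f ⇔ Holds x₀ x (classify f)
  classify-correct f x₀ x with ℚP.<-cmp (coeff f zero) 0ℚ
  ... | tri< k<0 _ _ = subst₂ (λ e r → 0ℚ ≤ e ⇔ x₀ ≤ r) (sym (eval-∷ f x₀ x))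
          (sym (eval-·ᵃ (- (1/ coeff f zero) {{ℚ.<-nonZero k<0}}) (dropHead f) x))
          (0≤kx+t⇔x≤root (coeff f zero) (eval (dropHead f) x) x₀ {{ℚ.<-nonZero k<0}} (ℚ.negative k<0))
  ... | tri≈ _ k≡0 _ = subst (λ e → 0ℚ ≤ e ⇔ x ⊨ dropHead f) (sym (begin
          eval f (x₀ ∷ᵥ x)                          ≡⟨ eval-∷ f x₀ x ⟩
          coeff f zero * x₀ + eval (dropHead f) x   ≡⟨ cong (λ k → k * x₀ + eval (dropHead f) x) k≡0 ⟩
          0ℚ * x₀ + eval (dropHead f) x             ≡⟨ cong (_+ eval (dropHead f) x) (ℚP.*-zeroˡ x₀) ⟩
          0ℚ + eval (dropHead f) x                  ≡⟨ ℚP.+-identityˡ _ ⟩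
          eval (dropHead f) x                       ∎))
          (mk⇔ (λ h → h) (λ h → h))
    where open ≡-Reasoning
  ... | tri> _ _ k>0 = subst₂ (λ e r → 0ℚ ≤ e ⇔ r ≤ x₀) (sym (eval-∷ f x₀ x))
          (sym (eval-·ᵃ (- (1/ coeff f zero) {{ℚ.>-nonZero k>0}}) (dropHead f) x))
          (0≤kx+t⇔root≤x (coeff f zero) (eval (dropHead f) x) x₀ {{ℚ.>-nonZero k>0}} (ℚ.positive k>0))


  lowers uppers frees : ∀ {m} → List (Bound m) → List (Affine m)
  lowers []             = []
  lowers (lower f ∷ bs) = f ∷ lowers bs
  lowers (upper _ ∷ bs) = lowers bs
  lowers (free _ ∷ bs)  = lowers bs
  uppers []             = []
  uppers (lower _ ∷ bs) = uppers bs
  uppers (upper f ∷ bs) = f ∷ uppers bs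
  uppers (free _ ∷ bs)  = uppers bs
  frees []              = []
  frees (lower _ ∷ bs)  = frees bs
  frees (upper _ ∷ bs)  = frees bs
  frees (free f ∷ bs)   = f ∷ frees bs

  module _ {m} {x₀ : ℚ} {x : Fin m → ℚ} where

    split : ∀ {bs} → All (Holds x₀ x) bs →
      All (λ f → eval f x ≤ x₀) (lowers bs) × All (λ f → x₀ ≤ eval f x) (uppers bs) × x ⊨* frees bs
    split {[]}          []       = [] , [] , []
    split {lower _ ∷ _} (h ∷ hs) = let ls , us , fs = split hs in h ∷ ls , us , fs
    split {upper _ ∷ _} (h ∷ hs) = let ls , us , fs = split hs in ls , h ∷ us , fs
    split {free _ ∷ _}  (h ∷ hs) = let ls , us , fs = split hs in ls , us , h ∷ fs

    join : ∀ bs → All (λ f → eval f x ≤ x₀) (lowers bs) → All (λ f → x₀ ≤ eval f x) (uppers bs) →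
      x ⊨* frees bs → All (Holds x₀ x) bs
    join []             _        _        _        = []
    join (lower _ ∷ bs) (l ∷ ls) us       fs       = l ∷ join bs ls us fs
    join (upper _ ∷ bs) ls       (u ∷ us) fs       = u ∷ join bs ls us fs
    join (free _ ∷ bs)  ls       us       (f ∷ fs) = f ∷ join bs ls us fs

  ⊨-ᵃ⇔ : ∀ {m} (u l : Affine m) x → x ⊨ (u -ᵃ l) ⇔ eval l x ≤ eval u x
  ⊨-ᵃ⇔ u l x = subst (λ e → 0ℚ ≤ e ⇔ eval l x ≤ eval u x) (sym (eval-subᵃ u l x)) 0≤-⇔≤

  between : ∀ {A : Set} (v : A → ℚ) (ls us : List A) → (∀ {l u} → l ∈ ls → u ∈ us → v l ≤ v u) →
    ∃ λ x₀ → All (λ l → v l ≤ x₀) ls × All (λ u → x₀ ≤ v u) us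
  between v ls us ls≤us = x₀ , All.map⁻ (xs≤max _ (map v ls)) , All.tabulate x₀≤
    where
    open import Data.List.Extrema (DecTotalOrder.totalOrder ℚP.≤-decTotalOrder)
    x₀ = max (min 0ℚ (map v us)) (map v ls)
    x₀≤ : ∀ {u} → u ∈ us → x₀ ≤ v u
    x₀≤ u∈us = max≤v⁺ (All.lookup (min≤xs 0ℚ (map v us)) (∈-map⁺ v u∈us))
                      (All.map⁺ (All.tabulate (λ l∈ls → ls≤us l∈ls u∈us)))

  eliminate : ∀ {m} → List (Affine (suc m)) → List (Affine m)
  eliminate fs = frees bs ++ cartesianProductWith _-ᵃ_ (uppers bs) (lowers bs)
    where bs = map classify fs

  eliminate-sound : ∀ {m} fs x₀ (x : Fin m → ℚ) → (x₀ ∷ᵥ x) ⊨* fs → x ⊨* eliminate fs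
  eliminate-sound fs x₀ x h = All.++⁺ frs
    (All.cartesianProductWith⁺ (setoid _) (setoid _) _-ᵃ_ (uppers bs) (lowers bs)
      (λ {u} {l} u∈ l∈ → Equivalence.from (⊨-ᵃ⇔ u l x) (ℚP.≤-trans (All.lookup ls l∈) (All.lookup us u∈))))
    where
    bs = map classify fs
    parts = split (All.map⁺ (All.map (λ {f} → Equivalence.to (classify-correct f x₀ x)) h))
    ls = proj₁ parts
    us = proj₁ (proj₂ parts)
    frs = proj₂ (proj₂ parts)

  eliminate-complete : ∀ {m} fs (x : Fin m → ℚ) → x ⊨* eliminate fs → ∃ λ x₀ → (x₀ ∷ᵥ x) ⊨* fs
  eliminate-complete fs x h = x₀ ,
    All.map (λ {f} → Equivalence.from (classify-correct f x₀ x)) (All.map⁻ (join bs ls us frs))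
    where
    bs = map classify fs
    frs = All.++⁻ˡ (frees bs) h
    ordered : ∀ {l u} → l ∈ lowers bs → u ∈ uppers bs → eval l x ≤ eval u x
    ordered {l} {u} l∈ u∈ = Equivalence.to (⊨-ᵃ⇔ u l x)
      (All.lookup (All.++⁻ʳ (frees bs) h) (∈-cartesianProductWith⁺ _-ᵃ_ u∈ l∈))
    bounds = between (λ f → eval f x) (lowers bs) (uppers bs) ordered
    x₀ = proj₁ bounds
    ls = proj₁ (proj₂ bounds)
    us = proj₂ (proj₂ bounds)

  feasible? : ∀ m (fs : List (Affine m)) → Dec (∃ λ x → x ⊨* fs)
  feasible? zero    fs = map′ (λ h → (λ ()) , h) proj₂ (All.all? (λ f → 0ℚ ℚP.≤? eval f (λ ())) fs)
  feasible? (suc m) fs = map′ extend restrict (feasible? m (eliminate fs))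
    where
    extend : ∃ (_⊨* eliminate fs) → ∃ (_⊨* fs)
    extend (x , h) = let x₀ , h₀ = eliminate-complete fs x h in (x₀ ∷ᵥ x) , h₀
    restrict : ∃ (_⊨* fs) → ∃ (_⊨* eliminate fs)
    restrict (x , h) = tail x , eliminate-sound fs (head x) (tail x) h

open FourierMotzkin using (Affine; affine; eval; _⊨_; _⊨*_; _·ᵃ_; eval-·ᵃ; feasible?)

-- The cone, the semigroup and its saturation

module _ {d n : ℕ} (a : Fin n → ℤVec d) where

  InK-resp : ∀ {p p' : ℚVec d} → p ≈ᵥ p' → InK a p → InK a p'
  InK-resp p≈p' (λ' , 0≤λ' , p≈) = λ' , 0≤λ' , λ k → trans (sym (p≈p' k)) (p≈ k)

  InQ-resp : ∀ {y y' : ℤVec d} → y ≈ᵥ y' → InQ a y → InQ a y'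
  InQ-resp y≈y' (μ , y≈) = μ , λ k → trans (sym (y≈y' k)) (y≈ k)

  InQsat-resp : ∀ {y y' : ℤVec d} → y ≈ᵥ y' → InQsat a y → InQsat a y'
  InQsat-resp y≈y' = InK-resp (cong toℚ ∘ y≈y')

  -- ratComb a λ' k is definitionally dotℚ λ' (column k).
  column : Fin d → Fin n → ℚ
  column k j = toℚ (a j k)

  InK-+ : ∀ {p p' : ℚVec d} → InK a p → InK a p' → InK a (λ k → p k ℚ.+ p' k)
  InK-+ (λ' , 0≤λ' , p≈) (ν , 0≤ν , p'≈) = (λ j → λ' j ℚ.+ ν j) ,
    (λ j → ℚP.+-mono-≤ (0≤λ' j) (0≤ν j)) ,
    λ k → trans (cong₂ ℚ._+_ (p≈ k) (p'≈ k)) (sym (dotℚ-+ˡ λ' ν (column k)))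

  InQsat-+ : ∀ {u v : ℤVec d} → InQsat a u → InQsat a v → InQsat a (u +ᵥ v)
  InQsat-+ {u} {v} u∈ v∈ = InK-resp (λ k → sym (toℚ-+ (u k) (v k))) (InK-+ u∈ v∈)

  intComb-+ : ∀ (x y : Fin n → ℤ) → intComb a (λ j → x j ℤ.+ y j) ≈ᵥ (intComb a x +ᵥ intComb a y)
  intComb-+ x y k = trans (sumℤ-cong (λ j → ℤP.*-distribʳ-+ (a j k) (x j) (y j)))
    (sumℤ-+ (λ j → x j ℤ.* a j k) (λ j → y j ℤ.* a j k))

  intComb-sub : ∀ (x y : Fin n → ℤ) → intComb a (λ j → x j ℤ.- y j) ≈ᵥ (intComb a x -ᵥ intComb a y)
  intComb-sub x y k = trans (intComb-+ x (ℤ.-_ ∘ y) k) (cong (ℤ._+_ (intComb a x k))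
    (trans (sumℤ-cong (λ j → sym (ℤP.neg-distribˡ-* (y j) (a j k)))) (sumℤ-neg (λ j → y j ℤ.* a j k))))

  InQ-+ : ∀ {u v : ℤVec d} → InQ a u → InQ a v → InQ a (u +ᵥ v)
  InQ-+ (μ , u≈) (ν , v≈) = (λ j → μ j ℕ.+ ν j) ,
    λ k → trans (cong₂ ℤ._+_ (u≈ k) (v≈ k)) (sym (intComb-+ (+_ ∘ μ) (+_ ∘ ν) k))

  toℚ-intComb : ∀ (x : Fin n → ℤ) k → toℚ (intComb a x k) ≡ ratComb a (toℚ ∘ x) k
  toℚ-intComb x k = trans (toℚ-sumℤ (λ j → x j ℤ.* a j k)) (sumℚ-cong (λ j → toℚ-* (x j) (a j k)))

  InQ⇒InQsat : ∀ {y} → InQ a y → InQsat a y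
  InQ⇒InQsat (μ , y≈) = toℚ ∘ +_ ∘ μ , toℚ-nonNeg ∘ μ ,
    λ k → trans (cong toℚ (y≈ k)) (toℚ-intComb (+_ ∘ μ) k)

  InQ-generator : ∀ j → InQ a (a j)
  InQ-generator j = δ j , λ k → sym (sumℤ-δ j (λ i → a i k))

  InQsat-generator : ∀ j → InQsat a (a j)
  InQsat-generator = InQ⇒InQsat ∘ InQ-generator

  intComb-∸ : ∀ (μ ν : Fin n → ℕ) → (∀ j → ν j ℕ.≤ μ j) →
    intComb a (+_ ∘ μ) ≈ᵥ (intComb a (λ j → + (μ j ℕ.∸ ν j)) +ᵥ intComb a (+_ ∘ ν))
  intComb-∸ μ ν ν≤μ k = trans
    (sumℤ-cong (λ j → cong (λ m → + m ℤ.* a j k) (sym (ℕP.m∸n+n≡m (ν≤μ j)))))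
    (intComb-+ (λ j → + (μ j ℕ.∸ ν j)) (+_ ∘ ν) k)

  InQ-minus-generator : ∀ (μ : Fin n → ℕ) j → μ j ≢ 0 → InQ a (intComb a (+_ ∘ μ) -ᵥ a j)
  InQ-minus-generator μ j μⱼ≢0 = μ-δⱼ , λ k → begin
    intComb a (+_ ∘ μ) k ℤ.- a j k                                      ≡⟨ cong (ℤ._- a j k) (intComb-∸ μ (δ j) (δ≤ j μⱼ≢0) k) ⟩
    (intComb a (+_ ∘ μ-δⱼ) k ℤ.+ intComb a (+_ ∘ δ j) k) ℤ.- a j k     ≡⟨ cong (λ e → (intComb a (+_ ∘ μ-δⱼ) k ℤ.+ e) ℤ.- a j k)
                                                                             (sumℤ-δ j (λ i → a i k)) ⟩
    (intComb a (+_ ∘ μ-δⱼ) k ℤ.+ a j k) ℤ.- a j k                      ≡⟨ solve 2 (λ r x → (r :+ x) :- x := r) refl _ (a j k) ⟩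
    intComb a (+_ ∘ μ-δⱼ) k                                            ∎
    where
    open ≡-Reasoning
    open ℤ-Solver.+-*-Solver using (solve; _:+_; _:-_; _:=_)
    μ-δⱼ : Fin n → ℕ
    μ-δⱼ i = μ i ℕ.∸ δ j i

  nonNegative : Fin n → Affine n
  nonNegative j = affine 0ℚ (λ i → toℚ (+ δ j i))

  residual : ℚVec d → Fin d → Affine n
  residual p k = affine (ℚ.- p k) (column k)

  coneSystem : ℚVec d → List (Affine n)
  coneSystem p = tabulate nonNegative ++ tabulate (residual p) ++ tabulate ((ℚ.- 1ℚ) ·ᵃ_ ∘ residual p)

  ⊨nonNegative⇔ : ∀ x j → x ⊨ nonNegative j ⇔ 0ℚ ℚ.≤ x j
  ⊨nonNegative⇔ x j = subst (λ e → 0ℚ ℚ.≤ e ⇔ 0ℚ ℚ.≤ x j)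
    (sym (trans (ℚP.+-identityˡ _) (sumℚ-δ j x))) (mk⇔ (λ h → h) (λ h → h))

  eval-residual : ∀ p k x → eval (residual p k) x ≡ ratComb a x k ℚ.- p k
  eval-residual p k x = trans (ℚP.+-comm (ℚ.- p k) _) (cong (ℚ._- p k) (dotℚ-comm (column k) x))

  ⊨residual⇔ : ∀ p k x → x ⊨ residual p k ⇔ p k ℚ.≤ ratComb a x k
  ⊨residual⇔ p k x = subst (λ e → 0ℚ ℚ.≤ e ⇔ p k ℚ.≤ ratComb a x k) (sym (eval-residual p k x)) 0≤-⇔≤

  ⊨-residual⇔ : ∀ p k x → x ⊨ ((ℚ.- 1ℚ) ·ᵃ residual p k) ⇔ ratComb a x k ℚ.≤ p k
  ⊨-residual⇔ p k x = subst (λ e → 0ℚ ℚ.≤ e ⇔ ratComb a x k ℚ.≤ p k) (sym (begin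
    eval ((ℚ.- 1ℚ) ·ᵃ residual p k) x       ≡⟨ eval-·ᵃ (ℚ.- 1ℚ) (residual p k) x ⟩
    ℚ.- 1ℚ ℚ.* eval (residual p k) x        ≡⟨ cong (ℚ.- 1ℚ ℚ.*_) (eval-residual p k x) ⟩
    ℚ.- 1ℚ ℚ.* (ratComb a x k ℚ.- p k)      ≡⟨ solve 2 (λ r q → :- con 1ℚ :* (r :- q) := q :- r) refl (ratComb a x k) (p k) ⟩
    p k ℚ.- ratComb a x k                   ∎)) 0≤-⇔≤
    where
    open ≡-Reasoning
    open +-*-Solver using (solve; _:-_; _:*_; :-_; _:=_; con)

  coneSystem-correct : ∀ p x → x ⊨* coneSystem p ⇔ ((∀ j → 0ℚ ℚ.≤ x j) × p ≈ᵥ ratComb a x)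
  coneSystem-correct p x = mk⇔ to from
    where
    to : x ⊨* coneSystem p → (∀ j → 0ℚ ℚ.≤ x j) × p ≈ᵥ ratComb a x
    to h = (λ j → Equivalence.to (⊨nonNegative⇔ x j) (All.tabulate⁻ nonNeg j)) ,
           (λ k → ℚP.≤-antisym (Equivalence.to (⊨residual⇔ p k x) (All.tabulate⁻ upper k))
                               (Equivalence.to (⊨-residual⇔ p k x) (All.tabulate⁻ lower k)))
      where
      nonNeg = All.++⁻ˡ (tabulate nonNegative) h
      upper = All.++⁻ˡ (tabulate (residual p)) (All.++⁻ʳ (tabulate nonNegative) h)
      lower = All.++⁻ʳ (tabulate (residual p)) (All.++⁻ʳ (tabulate nonNegative) h)
    from : (∀ j → 0ℚ ℚ.≤ x j) × p ≈ᵥ ratComb a x → x ⊨* coneSystem p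
    from (0≤x , p≈) = All.++⁺ (All.tabulate⁺ (λ j → Equivalence.from (⊨nonNegative⇔ x j) (0≤x j)))
      (All.++⁺ (All.tabulate⁺ (λ k → Equivalence.from (⊨residual⇔ p k x) (ℚP.≤-reflexive (p≈ k))))
               (All.tabulate⁺ (λ k → Equivalence.from (⊨-residual⇔ p k x) (ℚP.≤-reflexive (sym (p≈ k))))))

  -- Opaque so that `with` on decisions built from it does not try to unfold the elimination.
  opaque
    InK? : ∀ p → Dec (InK a p)
    InK? p = map′ (λ (x , h) → x , Equivalence.to (coneSystem-correct p x) h)
                  (λ (x , h) → x , Equivalence.from (coneSystem-correct p x) h)
                  (feasible? n (coneSystem p))

  InQsat? : ∀ y → Dec (InQsat a y)
  InQsat? y = InK? (toℚVec y)

  coordinateBound : Fin d → ℕ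
  coordinateBound k = ℤ.∣ sumℤ (λ j → + ℤ.∣ a j k ∣) ∣

  toℚ-coordinateBound : ∀ k → toℚ (+ coordinateBound k) ≡ sumℚ (λ j → ℚ.∣ column k j ∣)
  toℚ-coordinateBound k = begin
    toℚ (+ coordinateBound k)                   ≡⟨ toℚ-∣∣ (sumℤ (λ j → + ℤ.∣ a j k ∣)) ⟩
    ℚ.∣ toℚ (sumℤ (λ j → + ℤ.∣ a j k ∣)) ∣      ≡⟨ cong ℚ.∣_∣ (trans (toℚ-sumℤ (λ j → + ℤ.∣ a j k ∣))
                                                                   (sumℚ-cong (λ j → toℚ-∣∣ (a j k)))) ⟩
    ℚ.∣ sumℚ (λ j → ℚ.∣ column k j ∣) ∣         ≡⟨ ℚP.0≤p⇒∣p∣≡p (sumℚ-nonNeg (λ j → ℚP.0≤∣p∣ (column k j))) ⟩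
    sumℚ (λ j → ℚ.∣ column k j ∣)               ∎
    where open ≡-Reasoning

  fractional-bounded : ∀ (θ : Fin n → ℚ) → (∀ j → 0ℚ ℚ.≤ θ j) → (∀ j → θ j ℚ.≤ 1ℚ) →
    ∀ r k → toℚ r ≡ ratComb a θ k → ℤ.∣ r ∣ ℕ.≤ coordinateBound k
  fractional-bounded θ 0≤θ θ≤1 r k r≡ = ℤP.drop‿+≤+ (toℚ-cancel-≤ (begin
    toℚ (+ ℤ.∣ r ∣)                          ≡⟨ toℚ-∣∣ r ⟩
    ℚ.∣ toℚ r ∣                              ≡⟨ cong ℚ.∣_∣ r≡ ⟩
    ℚ.∣ ratComb a θ k ∣                      ≤⟨ ∣sumℚ∣≤sumℚ∣∣ (λ j → θ j ℚ.* column k j) ⟩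
    sumℚ (λ j → ℚ.∣ θ j ℚ.* column k j ∣)    ≤⟨ sumℚ-mono-≤ term≤ ⟩
    sumℚ (λ j → ℚ.∣ column k j ∣)            ≡⟨ toℚ-coordinateBound k ⟨
    toℚ (+ coordinateBound k)                ∎))
    where
    open ℚP.≤-Reasoning
    term≤ : ∀ j → ℚ.∣ θ j ℚ.* column k j ∣ ℚ.≤ ℚ.∣ column k j ∣
    term≤ j = begin
      ℚ.∣ θ j ℚ.* column k j ∣        ≡⟨ ℚP.∣p*q∣≡∣p∣*∣q∣ (θ j) (column k j) ⟩
      ℚ.∣ θ j ∣ ℚ.* ℚ.∣ column k j ∣  ≡⟨ cong (ℚ._* _) (ℚP.0≤p⇒∣p∣≡p (0≤θ j)) ⟩
      θ j ℚ.* ℚ.∣ column k j ∣        ≤⟨ ℚP.*-monoʳ-≤-nonNeg _ {{ℚP.∣-∣-nonNeg (column k j)}} (θ≤1 j) ⟩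
      1ℚ ℚ.* ℚ.∣ column k j ∣         ≡⟨ ℚP.*-identityˡ ℚ.∣ column k j ∣ ⟩
      ℚ.∣ column k j ∣                ∎

  Box : List (ℤVec d)
  Box = box coordinateBound

  decompose : ∀ z → InQsat a z → ∃ λ (m : Fin n → ℕ) → ∃ λ b →
    b ∈ Box × InQsat a b × z ≈ᵥ (intComb a (+_ ∘ m) +ᵥ b)
  decompose z (λ' , 0≤λ' , z≈) = m , b , b∈Box , InQsat-resp r≈b r∈Qsat , z≈I+b
    where
    open ℤ-Solver.+-*-Solver using (solve; _:+_; _:-_; _:=_)
    m : Fin n → ℕ
    m j = proj₁ (fractionalPart (λ' j) (0≤λ' j))
    θ : Fin n → ℚ
    θ j = λ' j ℚ.- toℚ (+ m j)
    I r : ℤVec d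
    I = intComb a (+_ ∘ m)
    r k = z k ℤ.- I k
    toℚ-r : ∀ k → toℚ (r k) ≡ ratComb a θ k
    toℚ-r k = begin
      toℚ (z k ℤ.- I k)                             ≡⟨ toℚ-sub (z k) (I k) ⟩
      toℚ (z k) ℚ.- toℚ (I k)                       ≡⟨ cong₂ ℚ._-_ (z≈ k) (toℚ-intComb (+_ ∘ m) k) ⟩
      ratComb a λ' k ℚ.- ratComb a (toℚ ∘ +_ ∘ m) k ≡⟨ dotℚ-subˡ λ' (toℚ ∘ +_ ∘ m) (column k) ⟨
      ratComb a θ k                                 ∎
      where open ≡-Reasoning
    r∈Qsat : InQsat a r
    r∈Qsat = θ , (λ j → proj₁ (proj₂ (fractionalPart (λ' j) (0≤λ' j)))) , toℚ-r
    r-bounded : ∀ k → ℤ.∣ r k ∣ ℕ.≤ coordinateBound k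
    r-bounded k = fractional-bounded θ (λ j → proj₁ (proj₂ (fractionalPart (λ' j) (0≤λ' j))))
      (λ j → proj₂ (proj₂ (fractionalPart (λ' j) (0≤λ' j)))) (r k) k (toℚ-r k)
    b = proj₁ (∈-box coordinateBound r r-bounded)
    b∈Box = proj₁ (proj₂ (∈-box coordinateBound r r-bounded))
    r≈b = proj₂ (proj₂ (∈-box coordinateBound r r-bounded))
    z≈I+b : z ≈ᵥ (I +ᵥ b)
    z≈I+b k = trans (solve 2 (λ z i → z := i :+ (z :- i)) refl (z k) (I k)) (cong (ℤ._+_ (I k)) (r≈b k))

  InQ-zero : InQ a zeroᵥ
  InQ-zero = (λ _ → 0) , λ k → sym (sumℤ-zero n)

  usedGenerator : ∀ (μ : Fin n → ℕ) → ¬ (intComb a (+_ ∘ μ) ≈ᵥ zeroᵥ) → ∃ λ j → μ j ≢ 0 × ¬ (a j ≈ᵥ zeroᵥ)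
  usedGenerator μ μa≉0 with any? (λ j → ¬? (μ j ℕ.≟ 0) ×-dec ¬? (≈ᵥ0? (a j)))
  ... | yes used = used
  ... | no none  = ⊥-elim (μa≉0 (λ k → trans (sumℤ-cong (λ j → term≡0 j k)) (sumℤ-zero n)))
    where
    term≡0 : ∀ j k → + μ j ℤ.* a j k ≡ + 0
    term≡0 j k with μ j ℕ.≟ 0 | ≈ᵥ0? (a j)
    ... | yes μⱼ≡0 | _        = cong (λ m → + m ℤ.* a j k) μⱼ≡0
    ... | no _     | yes aⱼ≈0 = trans (cong (+ μ j ℤ.*_) (aⱼ≈0 k)) (ℤP.*-zeroʳ (+ μ j))
    ... | no μⱼ≢0  | no aⱼ≉0  = ⊥-elim (none (j , μⱼ≢0 , aⱼ≉0))

  GeneratorHole : ℤVec d → Set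
  GeneratorHole y = ¬ (y ≈ᵥ zeroᵥ) × InQsat a y × (∀ j → ¬ (a j ≈ᵥ zeroᵥ) → ¬ InQsat a (y -ᵥ a j))

  generatorHole? : ∀ y → Dec (GeneratorHole y)
  generatorHole? y = ¬? (≈ᵥ0? y) ×-dec InQsat? y ×-dec
    all? (λ j → ¬? (≈ᵥ0? (a j)) →-dec ¬? (InQsat? (y -ᵥ a j)))

  GeneratorHole⇒FundamentalHole : ∀ {y} → GeneratorHole y → FundamentalHole a y
  GeneratorHole⇒FundamentalHole {y} (y≉0 , y∈ , irreducible) = y≉0 , y∈ , minimal
    where
    open ℤ-Solver.+-*-Solver using (solve; _:+_; _:-_; _:=_)
    minimal : ∀ q → InQ a q → InQsat a (y -ᵥ q) → (y -ᵥ q) ≈ᵥ y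
    minimal q (μ , q≈) y-q∈ with ≈ᵥ0? q
    ... | yes q≈0 = λ k → trans (cong (ℤ._-_ (y k)) (q≈0 k)) (ℤP.+-identityʳ (y k))
    ... | no q≉0  = ⊥-elim (irreducible j aⱼ≉0 (InQsat-resp y-q+[q-aⱼ]≈y-aⱼ
                      (InQsat-+ {y -ᵥ q} {intComb a (+_ ∘ μ) -ᵥ a j} y-q∈ (InQ⇒InQsat (InQ-minus-generator μ j μⱼ≢0)))))
      where
      used = usedGenerator μ (λ μa≈0 → q≉0 (λ k → trans (q≈ k) (μa≈0 k)))
      j = proj₁ used
      μⱼ≢0 = proj₁ (proj₂ used)
      aⱼ≉0 = proj₂ (proj₂ used)
      y-q+[q-aⱼ]≈y-aⱼ : ((y -ᵥ q) +ᵥ (intComb a (+_ ∘ μ) -ᵥ a j)) ≈ᵥ (y -ᵥ a j)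
      y-q+[q-aⱼ]≈y-aⱼ k rewrite sym (q≈ k) =
        solve 3 (λ y q x → (y :- q) :+ (q :- x) := y :- x) refl (y k) (q k) (a j k)

  measure : ℤVec d → ℕ
  measure b = count (λ s → InQsat? (b -ᵥ s)) Box

  measure-< : ∀ {b b' w} → b ∈ Box → b ≈ᵥ (b' +ᵥ w) → InQsat a w → ¬ InQsat a (λ k → ℤ.- w k) →
    measure b' ℕ.< measure b
  measure-< {b} {b'} {w} b∈Box b≈b'+w w∈ -w∉ =
    count-< (λ s → InQsat? (b' -ᵥ s)) (λ s → InQsat? (b -ᵥ s)) shift Box b∈Box b-b∈ b'-b∉
    where
    open ℤ-Solver.+-*-Solver using (solve; _:+_; _:-_; :-_; _:=_)
    shift : ∀ {s} → InQsat a (b' -ᵥ s) → InQsat a (b -ᵥ s)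
    shift {s} b'-s∈ = InQsat-resp (λ k → trans
      (solve 3 (λ b' s w → (b' :- s) :+ w := (b' :+ w) :- s) refl (b' k) (s k) (w k))
      (cong (ℤ._- s k) (sym (b≈b'+w k)))) (InQsat-+ {b' -ᵥ s} {w} b'-s∈ w∈)
    b-b∈ : InQsat a (b -ᵥ b)
    b-b∈ = InQsat-resp (λ k → sym (ℤP.+-inverseʳ (b k))) (InQ⇒InQsat InQ-zero)
    b'-b∉ : ¬ InQsat a (b' -ᵥ b)
    b'-b∉ = -w∉ ∘ InQsat-resp (λ k → trans (cong (ℤ._-_ (b' k)) (b≈b'+w k))
      (solve 2 (λ b' w → b' :- (b' :+ w) := :- w) refl (b' k) (w k)))

  height : ℚVec d → Fin n → ℚ
  height c j = dotℚ c (toℚVec (a j))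

  dotℚ-ratComb : ∀ (c : ℚVec d) (λ' : Fin n → ℚ) → dotℚ c (ratComb a λ') ≡ sumℚ (λ j → λ' j ℚ.* height c j)
  dotℚ-ratComb c λ' = begin
    sumℚ (λ k → c k ℚ.* sumℚ (λ j → λ' j ℚ.* column k j))     ≡⟨ sumℚ-cong (λ k → sumℚ-*ˡ (c k) (λ j → λ' j ℚ.* column k j)) ⟨
    sumℚ (λ k → sumℚ (λ j → c k ℚ.* (λ' j ℚ.* column k j)))   ≡⟨ sumℚ-comm (λ k j → c k ℚ.* (λ' j ℚ.* column k j)) ⟩
    sumℚ (λ j → sumℚ (λ k → c k ℚ.* (λ' j ℚ.* column k j)))   ≡⟨ sumℚ-cong (λ j → trans (sumℚ-cong (λ k → swap (c k) (λ' j) (column k j)))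
                                                                   (sumℚ-*ˡ (λ' j) (λ k → c k ℚ.* column k j))) ⟩
    sumℚ (λ j → λ' j ℚ.* height c j)                          ∎
    where
    open ≡-Reasoning
    open +-*-Solver using (solve; _:*_; _:=_)
    swap : ∀ x y z → x ℚ.* (y ℚ.* z) ≡ y ℚ.* (x ℚ.* z)
    swap = solve 3 (λ x y z → x :* (y :* z) := y :* (x :* z)) refl

  dotℚ-intComb : ∀ (c : ℚVec d) (μ : Fin n → ℕ) →
    dotℚ c (toℚVec (intComb a (+_ ∘ μ))) ≡ sumℚ (λ j → toℚ (+ μ j) ℚ.* height c j)
  dotℚ-intComb c μ = trans (sumℚ-cong (λ k → cong (c k ℚ.*_) (toℚ-intComb (+_ ∘ μ) k)))
    (dotℚ-ratComb c (toℚ ∘ +_ ∘ μ))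

  module _ (pointed : Pointed a) where

    Qsat∩-Qsat≈0 : ∀ {w} → InQsat a w → InQsat a (λ k → ℤ.- w k) → w ≈ᵥ zeroᵥ
    Qsat∩-Qsat≈0 {w} w∈ -w∈ k = toℚ-injective (pointed (toℚVec w) w∈ (InK-resp (toℚ-neg ∘ w) -w∈) k)

    -[aⱼ+Q]∉Qsat : ∀ j {v} → ¬ (a j ≈ᵥ zeroᵥ) → InQ a v → ¬ InQsat a (λ k → ℤ.- (a j k ℤ.+ v k))
    -[aⱼ+Q]∉Qsat j {v} aⱼ≉0 v∈ -[aⱼ+v]∈ = aⱼ≉0 (Qsat∩-Qsat≈0 (InQsat-generator j)
      (InQsat-resp (λ k → solve 2 (λ x v → :- (x :+ v) :+ v := :- x) refl (a j k) (v k))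
        (InQsat-+ {λ k → ℤ.- (a j k ℤ.+ v k)} {v} -[aⱼ+v]∈ (InQ⇒InQsat v∈))))
      where open ℤ-Solver.+-*-Solver using (solve; _:+_; :-_; _:=_)

    module _ {p : ℤVec d} (p∈Q : InQ a p)
             (saturates-hole : ∀ {s} → s ∈ Box → GeneratorHole s → InQ a (p +ᵥ s)) where

      saturates-box : ∀ {b} → b ∈ Box → InQsat a b → InQ a (p +ᵥ b)
      saturates-box {b} b∈Box b∈ = go b∈Box b∈ (<-wellFounded (measure b))
        where
        open ℤ-Solver.+-*-Solver using (solve; _:+_; _:-_; _:=_)
        go : ∀ {b} → b ∈ Box → InQsat a b → Acc ℕ._<_ (measure b) → InQ a (p +ᵥ b)
        go {b} b∈Box b∈ (acc smaller) with ≈ᵥ0? b | any? (λ j → ¬? (≈ᵥ0? (a j)) ×-dec InQsat? (b -ᵥ a j))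
        ... | yes b≈0 | _ = InQ-resp (λ k → sym (trans (cong (ℤ._+_ (p k)) (b≈0 k)) (ℤP.+-identityʳ (p k)))) p∈Q
        ... | no b≉0 | no irreducible =
          saturates-hole b∈Box (b≉0 , b∈ , λ j aⱼ≉0 b-aⱼ∈ → irreducible (j , aⱼ≉0 , b-aⱼ∈))
        ... | no _ | yes (j , aⱼ≉0 , b-aⱼ∈) =
          InQ-resp p+b'+w≈p+b (InQ-+ (go b'∈Box b'∈ (smaller b'<b)) (InQ-+ (InQ-generator j) I∈Q))
          where
          pieces = decompose (b -ᵥ a j) b-aⱼ∈
          m = proj₁ pieces
          b' = proj₁ (proj₂ pieces)
          b'∈Box = proj₁ (proj₂ (proj₂ pieces))
          b'∈ = proj₁ (proj₂ (proj₂ (proj₂ pieces)))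
          I = intComb a (+_ ∘ m)
          I∈Q : InQ a I
          I∈Q = m , λ _ → refl
          b≈b'+w : b ≈ᵥ (b' +ᵥ (a j +ᵥ I))
          b≈b'+w k = trans (solve 2 (λ b x → b := (b :- x) :+ x) refl (b k) (a j k))
            (trans (cong (ℤ._+ a j k) (proj₂ (proj₂ (proj₂ (proj₂ pieces))) k))
              (solve 3 (λ i b' x → (i :+ b') :+ x := b' :+ (x :+ i)) refl (I k) (b' k) (a j k)))
          b'<b : measure b' ℕ.< measure b
          b'<b = measure-< {b} {b'} {a j +ᵥ I} b∈Box b≈b'+w (InQ⇒InQsat (InQ-+ (InQ-generator j) I∈Q)) (-[aⱼ+Q]∉Qsat j aⱼ≉0 I∈Q)
          p+b'+w≈p+b : ((p +ᵥ b') +ᵥ (a j +ᵥ I)) ≈ᵥ (p +ᵥ b)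
          p+b'+w≈p+b k = trans (ℤP.+-assoc (p k) (b' k) (a j k ℤ.+ I k)) (cong (ℤ._+_ (p k)) (sym (b≈b'+w k)))

      saturationPoint : SaturationPoint a p
      saturationPoint = p∈Q , λ z z∈ → let m , b , b∈Box , b∈ , z≈I+b = decompose z z∈ in
        InQ-resp (p+b+I≈p+z m b z≈I+b) (InQ-+ (saturates-box b∈Box b∈) (m , λ _ → refl))
        where
        open ℤ-Solver.+-*-Solver using (solve; _:+_; _:=_)
        p+b+I≈p+z : ∀ {z} m b → z ≈ᵥ (intComb a (+_ ∘ m) +ᵥ b) → ((p +ᵥ b) +ᵥ intComb a (+_ ∘ m)) ≈ᵥ (p +ᵥ z)
        p+b+I≈p+z m b z≈I+b k = trans (solve 3 (λ p b i → (p :+ b) :+ i := p :+ (i :+ b)) refl (p k) (b k) (intComb a (+_ ∘ m) k))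
          (cong (ℤ._+_ (p k)) (sym (z≈I+b k)))

  module _ (c : ℚVec d) (fillable : ∀ y → FundamentalHole a y → HoleSystemFeasible a c y) where

    record Filler (s : ℤVec d) : Set where
      field
        coeffs : Fin n → ℕ
        fills  : GeneratorHole s → InQ a (s +ᵥ intComb a (+_ ∘ coeffs))
        onFace : ∀ j → coeffs j ≡ 0 ⊎ height c j ≡ 0ℚ
    open Filler

    filler : ∀ s → Filler s
    filler s with generatorHole? s
    ... | no ¬hole = record { coeffs = λ _ → 0 ; fills = ⊥-elim ∘ ¬hole ; onFace = λ _ → inj₁ refl }
    ... | yes hole = record { coeffs = negPart ∘ x ; fills = λ _ → posPart ∘ x , s+x⁻≈x⁺ ; onFace = x⁻-onFace }
      where
      feasible = fillable s (GeneratorHole⇒FundamentalHole hole)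
      x = proj₁ feasible
      s+x⁻≈x⁺ : (s +ᵥ intComb a (+_ ∘ negPart ∘ x)) ≈ᵥ intComb a (+_ ∘ posPart ∘ x)
      s+x⁻≈x⁺ k = begin
        s k ℤ.+ intComb a (+_ ∘ negPart ∘ x) k               ≡⟨ cong (ℤ._+ intComb a (+_ ∘ negPart ∘ x) k) (proj₁ (proj₂ feasible) k) ⟩
        intComb a x k ℤ.+ intComb a (+_ ∘ negPart ∘ x) k     ≡⟨ intComb-+ x (+_ ∘ negPart ∘ x) k ⟨
        intComb a (λ j → x j ℤ.+ + negPart (x j)) k          ≡⟨ sumℤ-cong (λ j → cong (ℤ._* a j k) (i+negPart≡posPart (x j))) ⟩
        intComb a (+_ ∘ posPart ∘ x) k                       ∎
        where open ≡-Reasoning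
      x⁻-onFace : ∀ j → negPart (x j) ≡ 0 ⊎ height c j ≡ 0ℚ
      x⁻-onFace j with height c j ℚP.≟ 0ℚ
      ... | yes hⱼ≡0 = inj₂ hⱼ≡0
      ... | no hⱼ≢0  = inj₁ (0≤i⇒negPart≡0 (proj₂ (proj₂ feasible) j (hⱼ≢0 ∘ proj₂)))

    P : Fin n → ℕ
    P j = sum (map (λ s → coeffs (filler s) j) Box)

    p : ℤVec d
    p = intComb a (+_ ∘ P)

    p∈Q : InQ a p
    p∈Q = P , λ _ → refl

    P-onFace : ∀ j → Dec (height c j ≡ 0ℚ) → P j ≡ 0 ⊎ height c j ≡ 0ℚ
    P-onFace j (yes hⱼ≡0) = inj₂ hⱼ≡0
    P-onFace j (no hⱼ≢0)  = inj₁ (sum-map-zero (λ s → coeffs (filler s) j)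
      (λ s → [ (λ gⱼ≡0 → gⱼ≡0) , ⊥-elim ∘ hⱼ≢0 ]′ (onFace (filler s) j)) Box)

    p-onFace : dotℚ c (toℚVec p) ≡ 0ℚ
    p-onFace = trans (dotℚ-intComb c P) (trans (sumℚ-cong term≡0) (sumℚ-zero n))
      where
      term≡0 : ∀ j → toℚ (+ P j) ℚ.* height c j ≡ 0ℚ
      term≡0 j = [ (λ Pⱼ≡0 → trans (cong (λ m → toℚ (+ m) ℚ.* height c j) Pⱼ≡0) (ℚP.*-zeroˡ (height c j)))
                 , (λ hⱼ≡0 → trans (cong (toℚ (+ P j) ℚ.*_) hⱼ≡0) (ℚP.*-zeroʳ (toℚ (+ P j)))) ]′
                 (P-onFace j (height c j ℚP.≟ 0ℚ))

    saturates-hole : ∀ {s} → s ∈ Box → GeneratorHole s → InQ a (p +ᵥ s)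
    saturates-hole {s} s∈Box hole =
      InQ-resp rest+[s+g]≈p+s (InQ-+ ((λ j → P j ℕ.∸ g j) , λ _ → refl) (fills (filler s) hole))
      where
      open ℤ-Solver.+-*-Solver using (solve; _:+_; _:=_)
      g = coeffs (filler s)
      rest = intComb a (λ j → + (P j ℕ.∸ g j))
      rest+[s+g]≈p+s : (rest +ᵥ (s +ᵥ intComb a (+_ ∘ g))) ≈ᵥ (p +ᵥ s)
      rest+[s+g]≈p+s k = trans (solve 3 (λ r s g → r :+ (s :+ g) := (r :+ g) :+ s) refl (rest k) (s k) (intComb a (+_ ∘ g) k))
        (cong (ℤ._+ s k) (sym (intComb-∸ P g (λ j → ∈⇒≤sum-map (λ s' → coeffs (filler s') j) s∈Box) k)))

    feasible⇒almostSaturated : Pointed a → AlmostSaturated a c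
    feasible⇒almostSaturated pointed = p , saturationPoint pointed p∈Q saturates-hole , (InQ⇒InQsat p∈Q , p-onFace)

  module _ (c : ℚVec d) (valid : ValidFunctional a c) where

    support-onFace : ∀ (μ : Fin n → ℕ) → dotℚ c (toℚVec (intComb a (+_ ∘ μ))) ≡ 0ℚ →
      ∀ j → μ j ≢ 0 → InFace a c (toℚVec (a j))
    support-onFace μ c·p≡0 j μⱼ≢0 = InQsat-generator j , p*q≡0⇒q≡0 (toℚ (+ μ j)) (height c j) μⱼ≢0′ termⱼ≡0
      where
      termⱼ≡0 : toℚ (+ μ j) ℚ.* height c j ≡ 0ℚ
      termⱼ≡0 = sumℚ-nonNeg-≡0 term≥0 (trans (sym (dotℚ-intComb c μ)) c·p≡0) j
        where
        term≥0 : ∀ i → 0ℚ ℚ.≤ toℚ (+ μ i) ℚ.* height c i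
        term≥0 i = subst (ℚ._≤ toℚ (+ μ i) ℚ.* height c i) (ℚP.*-zeroˡ (height c i)) (ℚP.*-monoʳ-≤-nonNeg (height c i)
          {{ℚ.nonNegative (valid (toℚVec (a i)) (InQsat-generator i))}} (toℚ-nonNeg (μ i)))
      μⱼ≢0′ : toℚ (+ μ j) ≢ 0ℚ
      μⱼ≢0′ = μⱼ≢0 ∘ ℤP.+-injective ∘ toℚ-injective {+ μ j} {+ 0}

    almostSaturated⇒feasible : AlmostSaturated a c → ∀ y → FundamentalHole a y → HoleSystemFeasible a c y
    almostSaturated⇒feasible (p , ((μ , p≈) , saturating) , (_ , c·p≡0)) y (_ , y∈ , _) = x , y≈ , x≥0
      where
      open ℤ-Solver.+-*-Solver using (solve; _:+_; _:-_; _:=_)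
      ν = proj₁ (saturating y y∈)
      x : Fin n → ℤ
      x j = + ν j ℤ.- + μ j
      y≈ : y ≈ᵥ intComb a x
      y≈ k = trans (solve 2 (λ p y → y := (p :+ y) :- p) refl (p k) (y k))
        (trans (cong₂ ℤ._-_ (proj₂ (saturating y y∈) k) (p≈ k)) (sym (intComb-sub (+_ ∘ ν) (+_ ∘ μ) k)))
      x≥0 : ∀ j → ¬ InFace a c (toℚVec (a j)) → + 0 ℤ.≤ x j
      x≥0 j notOnFace with μ j ℕ.≟ 0
      ... | yes μⱼ≡0 = subst (λ m → + 0 ℤ.≤ + ν j ℤ.- + m) (sym μⱼ≡0) (ℤ.+≤+ z≤n)
      ... | no μⱼ≢0  = ⊥-elim (notOnFace (support-onFace μ c·μa≡0 j μⱼ≢0))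
        where
        c·μa≡0 : dotℚ c (toℚVec (intComb a (+_ ∘ μ))) ≡ 0ℚ
        c·μa≡0 = trans (sumℚ-cong (λ k → cong (λ v → c k ℚ.* toℚ v) (sym (p≈ k)))) c·p≡0

theorem3p3 : (d n : ℕ) (a : Fin n → ℤVec d) →
    GeneratesLattice a → Pointed a →
    (c : ℚVec d) → ValidFunctional a c →
    AlmostSaturated a c ⇔ (∀ y → FundamentalHole a y → HoleSystemFeasible a c y)
theorem3p3 _ _ a _ pointed c valid =
  mk⇔ (almostSaturated⇒feasible a c valid) (λ fillable → feasible⇒almostSaturated a c fillable pointed)
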